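{- Let $(G,\prec)$ be a Nyldon-like set over $A$. Let $u_1,u_2,\dots,u_m$ be $G$-words such that for every $1\le i\le j\le m$, writing $w=u_iu_{i+1}\cdots u_j$: (1) every $G$-factorization of $w$ preserves the blocks $u_i,u_{i+1},\dots,u_j$; (2) if $w\in G$ and $i>1$, then $w\succeq u_i$. Then for all $1\le a<b\le m$ with $u_a\preceq u_{a+1}$, the word $u_au_{a+1}\cdots u_b$ is not in $G$.
   Context: $A$ is a finite alphabet with at least two letters. For $w\in A^+$, a $G$-factorization of $w$ is a sequence $(w_1,\dots,w_k)$, $k\ge 1$, of words of $G$ with $w=w_1w_2\cdots w_k$ and $w_1\preceq w_2\preceq\cdots\preceq w_k$. A Nyldon-like set is a pair $(G,\prec)$ with $G\subseteq A^+$ and $\prec$ a total order on $G$ such that: every letter of $A$ lies in $G$; a word $w$ of length at least $2$ lies in $G$ if and only if $w$ has no $G$-factorization with $k\ge 2$ factors; and for all $f,g\in G$ with $fg\in G$ we have $f\prec fg$. Elements of $G$ are called $G$-words, and $\preceq$ means $\prec$ or $=$. If $w=u_1u_2\cdots u_k$ is viewed as a concatenation of blocks $u_1,\dots,u_k$ (at fixed positions), a factorization $(n_1,\dots,n_r)$ of $w$ (i.e. $w=n_1\cdots n_r$) preserves the blocks if each $n_i$ is a concatenation of consecutive blocks, i.e. no factor starts or ends strictly inside a block. -}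

module Defs where

open import Level using (Level; _⊔_) renaming (suc to lsuc)
open import Data.Nat using (ℕ; zero; suc; _+_; _∸_; _≤_; _<_)
open import Data.Fin using (Fin)
open import Data.List using (List; []; _∷_; [_]; _++_; concat; map; upTo; length)
open import Data.List.Relation.Unary.All using (All)
open import Data.List.Relation.Unary.Linked using (Linked)
open import Data.Product using (Σ; ∃; _×_; _,_)
open import Data.Sum using (_⊎_)
open import Relation.Binary.PropositionalEquality using (_≡_; _≢_)
open import Relation.Nullary using (¬_)

Word : ℕ → Set
Word n = List (Fin n)

module _ {n : ℕ} where

  _⪯⟨_⟩_ : Word n → (Word n → Word n → Set) → Word n → Set
  x ⪯⟨ _≺_ ⟩ y = (x ≺ y) ⊎ (x ≡ y)

  record GFactorization (G : Word n → Set) (_≺_ : Word n → Word n → Set)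
                        (w : Word n) : Set where
    field
      factors  : List (Word n)
      nonempty : factors ≢ []
      allG     : All G factors
      product  : concat factors ≡ w
      sorted   : Linked (λ x y → x ⪯⟨ _≺_ ⟩ y) factors

  open GFactorization public

  numFactors : ∀ {G _≺_ w} → GFactorization G _≺_ w → ℕ
  numFactors F = length (factors F)

  record NyldonLike (G : Word n → Set) (_≺_ : Word n → Word n → Set) : Set where
    field
      G-nonempty : ∀ w → G w → w ≢ []
      ≺-irrefl   : ∀ x → G x → ¬ (x ≺ x)
      ≺-trans    : ∀ x y z → G x → G y → G z → x ≺ y → y ≺ z → x ≺ z
      ≺-total    : ∀ x y → G x → G y → (x ≺ y) ⊎ (x ≡ y) ⊎ (y ≺ x)
      letters    : ∀ (a : Fin n) → G [ a ]
      char       : ∀ w → 2 ≤ length w →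
                     (G w → ¬ (Σ (GFactorization G _≺_ w) λ F → 2 ≤ numFactors F))
                     × (¬ (Σ (GFactorization G _≺_ w) λ F → 2 ≤ numFactors F) → G w)
      prefix     : ∀ f g → G f → G g → G (f ++ g) → f ≺ (f ++ g)

  -- A factorization (list of factors) of the concatenation of a list of blocks
  -- preserves the blocks: each factor is a concatenation of a nonempty run of
  -- consecutive blocks.
  PreservesBlocks : List (Word n) → List (Word n) → Set
  PreservesBlocks blocks fs =
    Σ (List (List (Word n))) λ gs →
      All (λ g → g ≢ []) gs × concat gs ≡ blocks × map concat gs ≡ fs

  -- blocks u_i, u_{i+1}, …, u_j (1-indexed, for i ≤ j)
  blocks : (ℕ → Word n) → ℕ → ℕ → List (Word n)
  blocks u i j = map (λ k → u (i + k)) (upTo (suc (j ∸ i)))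

  segment : (ℕ → Word n) → ℕ → ℕ → Word n
  segment u i j = concat (blocks u i j)

-- If u_a u_{a+1} ⋯ u_b were a G-word, take any G-factorization (n₁, …, n_r) of
-- v = u_{a+1} ⋯ u_b. By (1) its first factor n₁ is a run u_{a+1} ⋯ u_c of blocks, so (2)
-- gives u_a ⪯ u_{a+1} ⪯ n₁, and (u_a, n₁, …, n_r) is a G-factorization of the G-word
-- u_a v with at least two factors, which is impossible.
module Submission where

open import Defs
open import Data.Nat using (ℕ; zero; suc; _+_; _≤_; _<_; z≤n; s≤s)
open import Data.Nat.Properties
  using (+-suc; +-identityʳ; m+n∸m≡n; m≤m+n; m≤n⇒∃[o]m+o≡n; ≤-trans; +-monoʳ-≤; n≤1+n)
open import Data.List using (List; []; _∷_; [_]; _++_; concat; applyUpTo; length; head)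
open import Data.List.Properties using (map-upTo; ++-identityʳ; ++-conicalˡ; ∷-injective)
open import Data.List.Relation.Unary.All using (All; []; _∷_) renaming (head to All-head)
open import Data.List.Relation.Unary.Linked using ([-]; _∷′_)
open import Data.Maybe using (just)
open import Data.Maybe.Relation.Binary.Connected using (Connected; just; just-nothing)
open import Data.Product using (Σ; ∃; _×_; _,_; proj₁; proj₂)
open import Data.Sum using (inj₁; inj₂)
open import Function using (_∘_)
open import Relation.Binary.PropositionalEquality
  using (_≡_; _≢_; refl; sym; trans; cong; cong₂; subst; _≗_; module ≡-Reasoning)
open import Relation.Nullary using (¬_)

applyUpTo-cong : ∀ {A : Set} {f g : ℕ → A} → f ≗ g → applyUpTo f ≗ applyUpTo g
applyUpTo-cong f≗g zero    = refl
applyUpTo-cong f≗g (suc k) = cong₂ _∷_ (f≗g 0) (applyUpTo-cong (f≗g ∘ suc) k)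

applyUpTo-prefix : ∀ {A : Set} (f : ℕ → A) k {g h : List A} →
  g ≢ [] → g ++ h ≡ applyUpTo f k → ∃ λ c → c < k × g ≡ applyUpTo f (suc c)
applyUpTo-prefix f k       {[]}         g≢[] _  with () ← g≢[] refl
applyUpTo-prefix f zero    {_ ∷ _}      _    ()
applyUpTo-prefix f (suc k) {x ∷ []}     _    eq
  with x≡ , _ ← ∷-injective eq
  = 0 , s≤s z≤n , cong [_] x≡
applyUpTo-prefix f (suc k) {x ∷ y ∷ g}  _    eq
  with x≡ , rest ← ∷-injective eq
  with c , c<k , g≡ ← applyUpTo-prefix (f ∘ suc) k (λ ()) rest
  = suc c , s≤s c<k , cong₂ _∷_ x≡ g≡

2≤length-++ : ∀ {A : Set} {xs ys : List A} → xs ≢ [] → ys ≢ [] → 2 ≤ length (xs ++ ys)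
2≤length-++ {xs = []}                xs≢[] _     with () ← xs≢[] refl
2≤length-++ {xs = _ ∷ []}     {[]}    _     ys≢[] with () ← ys≢[] refl
2≤length-++ {xs = _ ∷ []}     {_ ∷ _} _     _     = s≤s (s≤s z≤n)
2≤length-++ {xs = _ ∷ _ ∷ _}          _     _     = s≤s (s≤s z≤n)

head-connected : ∀ {A : Set} {R : A → A → Set} x (xs : List A) →
  (∀ {y ys} → xs ≡ y ∷ ys → R x y) → Connected R (just x) (head xs)
head-connected x []       _     = just-nothing
head-connected x (y ∷ ys) R-head = just (R-head refl)

module _ {n : ℕ} where

  blocks-applyUpTo : ∀ (u : ℕ → Word n) i d → blocks u i (i + d) ≡ applyUpTo (u ∘ (i +_)) (suc d)
  blocks-applyUpTo u i d rewrite m+n∸m≡n i d = map-upTo (u ∘ (i +_)) (suc d)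

  segment-unfold : ∀ (u : ℕ → Word n) i d →
    segment u i (suc i + d) ≡ u i ++ segment u (suc i) (suc i + d)
  segment-unfold u i d = begin
      concat (blocks u i (suc i + d))
        ≡⟨ cong (concat ∘ blocks u i) (sym (+-suc i d)) ⟩
      concat (blocks u i (i + suc d))
        ≡⟨ cong concat (blocks-applyUpTo u i (suc d)) ⟩
      u (i + 0) ++ concat (applyUpTo (λ k → u (i + suc k)) (suc d))
        ≡⟨ cong₂ (λ x ys → x ++ concat ys) (cong u (+-identityʳ i))
                 (applyUpTo-cong (cong u ∘ +-suc i) (suc d)) ⟩
      u i ++ concat (applyUpTo (u ∘ (suc i +_)) (suc d))
        ≡⟨ cong ((u i ++_) ∘ concat) (sym (blocks-applyUpTo u (suc i) d)) ⟩
      u i ++ segment u (suc i) (suc i + d) ∎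
    where open ≡-Reasoning

  segment-≢[] : ∀ (u : ℕ → Word n) i d → u i ≢ [] → segment u i (i + d) ≢ []
  segment-≢[] u i d uᵢ≢[] segment≡[] = uᵢ≢[] (subst (λ k → u k ≡ []) (+-identityʳ i)
    (++-conicalˡ (u (i + 0)) _ (trans (sym (cong concat (blocks-applyUpTo u i d))) segment≡[])))

  PreservesBlocks-head : ∀ (u : ℕ → Word n) i d {y ys} →
    PreservesBlocks (blocks u i (i + d)) (y ∷ ys) →
    ∃ λ c → c ≤ d × y ≡ segment u i (i + c)
  PreservesBlocks-head u i d (g ∷ gs , g≢[] ∷ _ , concat≡ , refl)
    with c , s≤s c≤d , g≡ ← applyUpTo-prefix (u ∘ (i +_)) (suc d) g≢[]
                                (trans concat≡ (blocks-applyUpTo u i d))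
    = c , c≤d , cong concat (trans g≡ (sym (blocks-applyUpTo u i c)))

  module NyldonLikeFacts {G : Word n → Set} {_≺_ : Word n → Word n → Set}
                         (NL : NyldonLike G _≺_) where
    open NyldonLike NL

    _⪯_ : Word n → Word n → Set
    x ⪯ y = x ⪯⟨ _≺_ ⟩ y

    ⪯-trans : ∀ {x y z} → G x → G y → G z → x ⪯ y → y ⪯ z → x ⪯ z
    ⪯-trans Gx Gy Gz (inj₁ x≺y) (inj₁ y≺z) = inj₁ (≺-trans _ _ _ Gx Gy Gz x≺y y≺z)
    ⪯-trans _  _  _  (inj₂ refl) y⪯z         = y⪯z
    ⪯-trans _  _  _  x⪯y         (inj₂ refl) = x⪯y

    singleton : ∀ {w} → G w → GFactorization G _≺_ w
    singleton {w} Gw = record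
      { factors = [ w ] ; nonempty = λ () ; allG = Gw ∷ []
      ; product = ++-identityʳ w ; sorted = [-] }

    unfactorizable⇒G : ∀ {w} → w ≢ [] → ¬ GFactorization G _≺_ w → G w
    unfactorizable⇒G {[]}        w≢[] _   with () ← w≢[] refl
    unfactorizable⇒G {x ∷ []}    _    _   = letters x
    unfactorizable⇒G {x ∷ y ∷ w} _    noF =
      char (x ∷ y ∷ w) (s≤s (s≤s z≤n)) .proj₂ (λ (F , _) → noF F)

    -- G is not decidable, so existence of a factorization only holds doubly negated.
    ¬¬-GFactorization : ∀ {w} → w ≢ [] → ¬ ¬ GFactorization G _≺_ w
    ¬¬-GFactorization w≢[] noF = noF (singleton (unfactorizable⇒G w≢[] noF))

    prepend : ∀ {x v} → G x → (F : GFactorization G _≺_ v) →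
      (∀ {y ys} → factors F ≡ y ∷ ys → x ⪯ y) →
      Σ (GFactorization G _≺_ (x ++ v)) λ F′ → 2 ≤ numFactors F′
    prepend {x} Gx F x⪯head = F′ , 2≤length-++ {xs = [ x ]} (λ ()) (nonempty F)
      where
        F′ : GFactorization G _≺_ (x ++ _)
        F′ = record
          { factors  = x ∷ factors F
          ; nonempty = λ ()
          ; allG     = Gx ∷ allG F
          ; product  = cong (x ++_) (product F)
          ; sorted   = head-connected x (factors F) x⪯head ∷′ sorted F }

    ¬G-when-⪯-first-factors : ∀ {x v} → G x → v ≢ [] →
      (∀ (F : GFactorization G _≺_ v) {y ys} → factors F ≡ y ∷ ys → x ⪯ y) →
      ¬ G (x ++ v)
    ¬G-when-⪯-first-factors {x} {v} Gx v≢[] x⪯head Gxv = ¬¬-GFactorization v≢[] λ F →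
      char (x ++ v) (2≤length-++ (G-nonempty x Gx) v≢[]) .proj₁
        Gxv (prepend Gx F (x⪯head F))

lemma3p2 : (n : ℕ) → 2 ≤ n →
    (G : Word n → Set) (_≺_ : Word n → Word n → Set) → NyldonLike G _≺_ →
    (m : ℕ) (u : ℕ → Word n) →
    (∀ i → 1 ≤ i → i ≤ m → G (u i)) →
    (∀ i j → 1 ≤ i → i ≤ j → j ≤ m →
      (F : GFactorization G _≺_ (segment u i j)) →
        PreservesBlocks (blocks u i j) (factors F)) →
    (∀ i j → 1 ≤ i → i ≤ j → j ≤ m →
      G (segment u i j) → 1 < i → u i ⪯⟨ _≺_ ⟩ segment u i j) →
    ∀ a b → 1 ≤ a → a < b → b ≤ m →
      u a ⪯⟨ _≺_ ⟩ u (suc a) →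
      ¬ G (segment u a b)
lemma3p2 n _ G _≺_ NL m u G-u preserves ⪯-segment a b 1≤a a<b b≤m uₐ⪯uₐ₊₁
  with d , refl ← m≤n⇒∃[o]m+o≡n a<b
  rewrite segment-unfold u a d
  = ¬G-when-⪯-first-factors Guₐ (segment-≢[] u (suc a) d (G-nonempty _ Guₐ₊₁)) uₐ⪯head
  where
    open NyldonLike NL using (G-nonempty)
    open NyldonLikeFacts NL

    Guₐ₊₁ : G (u (suc a))
    Guₐ₊₁ = G-u (suc a) (s≤s z≤n) (≤-trans (m≤m+n (suc a) d) b≤m)

    Guₐ : G (u a)
    Guₐ = G-u a 1≤a (≤-trans (n≤1+n a) (≤-trans (m≤m+n (suc a) d) b≤m))

    uₐ⪯head : ∀ (F : GFactorization G _≺_ (segment u (suc a) (suc a + d))) {y ys} →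
      factors F ≡ y ∷ ys → u a ⪯ y
    uₐ⪯head F {y} factors≡
      with c , c≤d , refl ← PreservesBlocks-head u (suc a) d
             (subst (PreservesBlocks _) factors≡ (preserves _ _ (s≤s z≤n) (m≤m+n _ _) b≤m F))
      = ⪯-trans Guₐ Guₐ₊₁ Gy uₐ⪯uₐ₊₁
          (⪯-segment _ _ (s≤s z≤n) (m≤m+n _ _) (≤-trans (+-monoʳ-≤ (suc a) c≤d) b≤m) Gy (s≤s 1≤a))
      where
        Gy : G y
        Gy = All-head (subst (All G) factors≡ (allG F))
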